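{- Let $n\geq 1$ and $x\in\{1,\dots,n\}$. Let $k\geq 2$ satisfy $F_k\leq x<F_{k+1}$ and let $\ell\geq k$ satisfy $F_\ell\leq x+n<F_{\ell+1}$. Then $$\deg_{G_n}(x)=\begin{cases}\ell-k-1 & \text{if } x=1, \text{ or if } k\geq 4 \text{ and } x=\tfrac{1}{2}F_{k+2},\\ \ell-k & \text{otherwise}.\end{cases}$$
   Context: The Fibonacci numbers are defined by $F_0=0$, $F_1=1$ and $F_m=F_{m-1}+F_{m-2}$ for $m\geq 2$. For each integer $n\geq 1$, the Fibonacci-sum graph $G_n$ is the simple graph with vertex set $\{1,2,\dots,n\}$ in which distinct vertices $i,j$ are adjacent if and only if $i+j$ is a Fibonacci number. -}

module Defs where

open import Data.Nat using (ℕ; zero; suc; _+_; _≤_; _<_; _≟_; z≤n; s≤s)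
open import Data.Nat.Properties using (≤-trans; n≤1+n; ≤-refl; +-mono-≤; m≤m+n; +-comm; m≤n⇒m<n∨m≡n)
open import Data.Product using (Σ; _,_; _×_; ∃)
open import Data.Sum using (inj₁; inj₂)
open import Data.Empty using (⊥)
open import Data.List using (List; length; filter; upTo; map)
open import Relation.Nullary using (Dec; yes; no; ¬_)
open import Relation.Nullary.Decidable using (_×-dec_; ¬?)
open import Relation.Binary.PropositionalEquality using (_≡_; refl; subst)

F : ℕ → ℕ
F zero = 0
F (suc zero) = 1
F (suc (suc m)) = F (suc m) + F m

IsFib : ℕ → Set
IsFib m = ∃ λ k → F k ≡ m

1≤F[1+k] : ∀ k → 1 ≤ F (suc k)
1≤F[1+k] zero = s≤s z≤n
1≤F[1+k] (suc k) = ≤-trans (1≤F[1+k] k) (m≤m+n (F (suc k)) (F k))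

k≤1+F : ∀ k → k ≤ suc (F k)
k≤1+F zero = z≤n
k≤1+F (suc zero) = s≤s z≤n
k≤1+F (suc (suc zero)) = s≤s (s≤s z≤n)
k≤1+F (suc (suc (suc k))) =
  subst (_≤ suc (F (suc (suc k)) + F (suc k))) (+-comm (suc (suc k)) 1)
    (+-mono-≤ (k≤1+F (suc (suc k))) (1≤F[1+k] k))

private
  search : (m b : ℕ) → Dec (Σ ℕ λ j → (j < b) × (F j ≡ m))
  search m zero = no λ { (j , () , _) }
  search m (suc b) with F b ≟ m | search m b
  ... | yes e | _ = yes (b , ≤-refl , e)
  ... | no _ | yes (j , j<b , e) = yes (j , ≤-trans j<b (n≤1+n b) , e)
  ... | no ne | no nr = no λ { (j , j<sb , e) → help j j<sb e }
    where
    help : ∀ j → j < suc b → F j ≡ m → ⊥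
    help j (s≤s j≤b) e with m≤n⇒m<n∨m≡n j≤b
    ... | inj₁ j<b = nr (j , j<b , e)
    ... | inj₂ refl = ne e

isFib? : (m : ℕ) → Dec (IsFib m)
isFib? m with search m (suc (suc m))
... | yes (j , _ , e) = yes (j , e)
... | no nr = no λ { (j , e) → nr (j , s≤s (subst (λ t → j ≤ suc t) e (k≤1+F j)) , e) }

Adj : ℕ → ℕ → Set
Adj i j = (¬ (i ≡ j)) × IsFib (i + j)

Adj? : (i j : ℕ) → Dec (Adj i j)
Adj? i j = ¬? (i ≟ j) ×-dec isFib? (i + j)

vertices : ℕ → List ℕ
vertices n = map suc (upTo n)

deg : (n x : ℕ) → ℕ
deg n x = length (filter (Adj? x) (vertices n))

module Submission where

-- Write [φ] for the 0/1 indicator of a decidable φ and let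
-- fibCount v be the number of Fibonacci numbers in {1,…,v}.
--  (1) Fibonacci interval index:  if 2 ≤ ℓ and F ℓ ≤ v < F (ℓ+1), then
--      fibCount v + 1 = ℓ (the Fibonacci values up to v are F 2, …, F ℓ).
--  (2) Counting neighbours:  a vertex y ≠ x is adjacent to x exactly when
--      x + y is Fibonacci, and y ↦ x + y maps {1,…,n} onto {x+1,…,x+n}.
--      Only y = x is lost, and it is a vertex as soon as x ≤ n, so
--      deg n x + [2x Fibonacci] + fibCount x = fibCount (x + n).
--  (3) Doubling:  if 2 ≤ k and F k ≤ x < F (k+1), then 2x is Fibonacci iff
--      x = 1 or (4 ≤ k and 2x = F (k+2)), because F (k+1) < 2x < F (k+3)
--      once k ≥ 3, which leaves only 2x = F (k+2), impossible for k = 3.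
-- Combining (1) for v = x and v = x + n with (2) gives
-- deg n x + [2x Fibonacci] + k = ℓ, and (3) evaluates the indicator.

open import Defs
open import Data.Nat using (ℕ; zero; suc; _+_; _*_; _≤_; _<_; z≤n; s≤s; _≟_; _<?_)
open import Data.Nat.Properties
  using (≤-refl; ≤-reflexive; ≤-trans; ≤-antisym; ≤-pred; <-irrefl; <-trans; <-≤-trans; <⇒≤; <⇒≱; <⇒≢; ≮⇒≥;
         n<1+n; m≤n⇒m<n∨m≡n; m≤m+n; m<m+n; +-identityʳ; +-suc; +-comm; +-assoc;
         +-mono-≤; +-monoʳ-<; +-mono-≤-<; +-commutativeSemigroup)
open import Data.Product using (_×_; _,_; proj₁)
open import Data.Sum using (_⊎_; inj₁; inj₂)
open import Data.List using ([]; _∷_; _++_; length; filter; upTo; map)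
open import Data.List.Properties using (upTo-∷ʳ; map-++; length-++; filter-++)
open import Relation.Nullary using (¬_; Dec; yes; no; contradiction)
open import Relation.Unary using (Pred; Decidable)
open import Relation.Binary.PropositionalEquality using (_≡_; _≢_; refl; sym; trans; cong; module ≡-Reasoning)
open import Function using (_∘_)
open import Algebra.Properties.CommutativeSemigroup +-commutativeSemigroup using (xy∙z≈xz∙y)

𝟙 : ∀ {a} {A : Set a} → Dec A → ℕ
𝟙 (yes _) = 1
𝟙 (no _) = 0

𝟙-yes : ∀ {a} {A : Set a} (d : Dec A) → A → 𝟙 d ≡ 1
𝟙-yes (yes _) _ = refl
𝟙-yes (no ¬a) a = contradiction a ¬a

𝟙-no : ∀ {a} {A : Set a} (d : Dec A) → ¬ A → 𝟙 d ≡ 0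
𝟙-no (yes a) ¬a = contradiction a ¬a
𝟙-no (no _) _ = refl

F-step : ∀ m → F m ≤ F (suc m)
F-step zero = z≤n
F-step (suc m) = m≤m+n (F (suc m)) (F m)

F-strict : ∀ m → F (suc (suc m)) < F (suc (suc (suc m)))
F-strict m = m<m+n (F (suc (suc m))) (1≤F[1+k] m)

F-mono : ∀ {m n} → m ≤ n → F m ≤ F n
F-mono {m} {zero} z≤n = ≤-refl
F-mono {m} {suc n} m≤1+n with m≤n⇒m<n∨m≡n m≤1+n
... | inj₁ (s≤s m≤n) = ≤-trans (F-mono m≤n) (F-step n)
... | inj₂ refl = ≤-refl

F-reflects-< : ∀ m n → F m < F n → m < n
F-reflects-< m n Fm<Fn with m <? n
... | yes m<n = m<n
... | no m≮n = contradiction (F-mono (≮⇒≥ m≮n)) (<⇒≱ Fm<Fn)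

fib-in-interval : ∀ {v} ℓ → F ℓ ≤ v → v < F (suc ℓ) → IsFib v → v ≡ F ℓ
fib-in-interval ℓ lo hi (j , refl) =
  ≤-antisym (F-mono (≤-pred (F-reflects-< j (suc ℓ) hi))) lo

fib-between : ∀ {v} a → F a < v → v < F (suc (suc a)) → IsFib v → v ≡ F (suc a)
fib-between a lo hi (j , refl) =
  cong F (≤-antisym (≤-pred (F-reflects-< j (suc (suc a)) hi)) (F-reflects-< a j lo))

-- The number of Fibonacci numbers among 1, …, v (values, not indices).
fibCount : ℕ → ℕ
fibCount zero = 0
fibCount (suc v) = fibCount v + 𝟙 (isFib? (suc v))

-- The Fibonacci values up to v ∈ [F ℓ, F (ℓ+1)) are F 2 < ⋯ < F ℓ.
-- Induction on v: a non-Fibonacci v + 1 adds nothing and stays in the same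
-- interval; a Fibonacci v + 1 = F ℓ adds one, and v lies in the previous one.
fibCount-index : ∀ v ℓ → 2 ≤ ℓ → F ℓ ≤ v → v < F (suc ℓ) → fibCount v + 1 ≡ ℓ
fibCount-index zero (suc (suc m)) _ lo _ = contradiction lo (<⇒≱ (1≤F[1+k] (suc m)))
fibCount-index (suc w) ℓ 2≤ℓ lo hi with isFib? (suc w)
... | yes fib = new-value ℓ 2≤ℓ (fib-in-interval ℓ lo hi fib)
  where
  new-value : ∀ ℓ → 2 ≤ ℓ → suc w ≡ F ℓ → fibCount w + 1 + 1 ≡ ℓ
  new-value (suc zero) (s≤s ())
  new-value (suc (suc zero)) _ refl = refl
  new-value (suc (suc (suc m))) _ v≡F =
    trans (+-comm (fibCount w + 1) 1) (cong suc (fibCount-index w (suc (suc m)) (s≤s (s≤s z≤n)) below-w w<F))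
    where
    w<F : w < F (suc (suc (suc m)))
    w<F = ≤-trans (n<1+n w) (≤-reflexive v≡F)
    below-w : F (suc (suc m)) ≤ w
    below-w = ≤-pred (≤-trans (F-strict m) (≤-reflexive (sym v≡F)))
... | no not-fib = trans (cong (_+ 1) (+-identityʳ (fibCount w)))
                     (fibCount-index w ℓ 2≤ℓ lo-w (<-trans (n<1+n w) hi))
  where
  lo-w : F ℓ ≤ w
  lo-w with m≤n⇒m<n∨m≡n lo
  ... | inj₁ (s≤s Fℓ≤w) = Fℓ≤w
  ... | inj₂ Fℓ≡v = contradiction (ℓ , Fℓ≡v) not-fib

length-filter-[_] : ∀ {a p} {A : Set a} {P : Pred A p} (P? : Decidable P) (y : A) →
  length (filter P? (y ∷ [])) ≡ 𝟙 (P? y)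
length-filter-[ P? ] y with P? y
... | yes _ = refl
... | no _ = refl

deg-suc : ∀ m x → deg (suc m) x ≡ deg m x + 𝟙 (Adj? x (suc m))
deg-suc m x = begin
  length (filter (Adj? x) (map suc (upTo (suc m))))
    ≡⟨ cong (λ l → length (filter (Adj? x) (map suc l))) (sym (upTo-∷ʳ m)) ⟩
  length (filter (Adj? x) (map suc (upTo m ++ m ∷ [])))
    ≡⟨ cong (λ l → length (filter (Adj? x) l)) (map-++ suc (upTo m) (m ∷ [])) ⟩
  length (filter (Adj? x) (map suc (upTo m) ++ suc m ∷ []))
    ≡⟨ cong length (filter-++ (Adj? x) (map suc (upTo m)) (suc m ∷ [])) ⟩
  length (filter (Adj? x) (map suc (upTo m)) ++ filter (Adj? x) (suc m ∷ []))
    ≡⟨ length-++ (filter (Adj? x) (map suc (upTo m))) ⟩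
  deg m x + length (filter (Adj? x) (suc m ∷ []))
    ≡⟨ cong (deg m x +_) (length-filter-[ Adj? x ] (suc m)) ⟩
  deg m x + 𝟙 (Adj? x (suc m)) ∎
  where open ≡-Reasoning

adj-other : ∀ {x y} → x ≢ y → 𝟙 (Adj? x y) ≡ 𝟙 (isFib? (x + y))
adj-other {x} {y} x≢y with x ≟ y | isFib? (x + y)
... | yes x≡y | _ = contradiction x≡y x≢y
... | no _ | yes _ = refl
... | no _ | no _ = refl

adj-self : ∀ x → 𝟙 (Adj? x x) ≡ 0
adj-self x = 𝟙-no (Adj? x x) (λ adj → proj₁ adj refl)

swap-last : ∀ a b c d → a + b + c + d ≡ a + c + d + b
swap-last a b c d = trans (cong (_+ d) (xy∙z≈xz∙y a b c)) (xy∙z≈xz∙y (a + c) b d)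

fibCount-+suc : ∀ x m → fibCount (x + suc m) ≡ fibCount (x + m) + 𝟙 (isFib? (x + suc m))
fibCount-+suc x m rewrite +-suc x m = refl

-- While the vertex x itself has not been added (m < x), the neighbours of
-- x in G_m correspond to the Fibonacci values in {x+1, …, x+m}.
deg-below : ∀ x m → m < x → deg m x + fibCount x ≡ fibCount (x + m)
deg-below x zero _ = cong fibCount (sym (+-identityʳ x))
deg-below x (suc m) m<x = begin
  deg (suc m) x + fibCount x                      ≡⟨ cong (_+ fibCount x) (deg-suc m x) ⟩
  deg m x + 𝟙 (Adj? x (suc m)) + fibCount x       ≡⟨ cong (λ t → deg m x + t + fibCount x) (adj-other x≢1+m) ⟩
  deg m x + 𝟙 (isFib? (x + suc m)) + fibCount x   ≡⟨ xy∙z≈xz∙y (deg m x) _ (fibCount x) ⟩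
  deg m x + fibCount x + 𝟙 (isFib? (x + suc m))
    ≡⟨ cong (_+ 𝟙 (isFib? (x + suc m))) (deg-below x m (<-trans (n<1+n m) m<x)) ⟩
  fibCount (x + m) + 𝟙 (isFib? (x + suc m))       ≡⟨ sym (fibCount-+suc x m) ⟩
  fibCount (x + suc m) ∎
  where
  open ≡-Reasoning
  x≢1+m : x ≢ suc m
  x≢1+m x≡1+m = <-irrefl (sym x≡1+m) m<x

-- Once x is a vertex (x ≤ m), exactly one Fibonacci value of {x+1, …, x+m},
-- namely 2x when it is Fibonacci, is not realised by a neighbour.
deg-from : ∀ x m → 1 ≤ x → x ≤ m →
  deg m x + 𝟙 (isFib? (x + x)) + fibCount x ≡ fibCount (x + m)
deg-from x zero 1≤x x≤0 = contradiction (≤-trans 1≤x x≤0) λ ()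
deg-from x (suc m) 1≤x x≤1+m with m≤n⇒m<n∨m≡n x≤1+m
... | inj₁ (s≤s x≤m) = begin
  deg (suc m) x + T + fibCount x                    ≡⟨ cong (λ d → d + T + fibCount x) (deg-suc m x) ⟩
  deg m x + 𝟙 (Adj? x (suc m)) + T + fibCount x     ≡⟨ cong (λ t → deg m x + t + T + fibCount x) (adj-other x≢1+m) ⟩
  deg m x + 𝟙 (isFib? (x + suc m)) + T + fibCount x ≡⟨ swap-last (deg m x) _ T (fibCount x) ⟩
  deg m x + T + fibCount x + 𝟙 (isFib? (x + suc m)) ≡⟨ cong (_+ 𝟙 (isFib? (x + suc m))) (deg-from x m 1≤x x≤m) ⟩
  fibCount (x + m) + 𝟙 (isFib? (x + suc m))         ≡⟨ sym (fibCount-+suc x m) ⟩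
  fibCount (x + suc m) ∎
  where
  open ≡-Reasoning
  T = 𝟙 (isFib? (x + x))
  x≢1+m : x ≢ suc m
  x≢1+m x≡1+m = <-irrefl x≡1+m (s≤s x≤m)
... | inj₂ refl = begin
  deg (suc m) x + T + fibCount x                    ≡⟨ cong (λ d → d + T + fibCount x) (deg-suc m x) ⟩
  deg m x + 𝟙 (Adj? x x) + T + fibCount x           ≡⟨ cong (λ t → deg m x + t + T + fibCount x) (adj-self x) ⟩
  deg m x + 0 + T + fibCount x                      ≡⟨ cong (λ d → d + T + fibCount x) (+-identityʳ (deg m x)) ⟩
  deg m x + T + fibCount x                          ≡⟨ xy∙z≈xz∙y (deg m x) T (fibCount x) ⟩
  deg m x + fibCount x + T                          ≡⟨ cong (_+ T) (deg-below x m ≤-refl) ⟩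
  fibCount (x + m) + T                              ≡⟨ sym (fibCount-+suc x m) ⟩
  fibCount (x + suc m) ∎
  where
  open ≡-Reasoning
  T = 𝟙 (isFib? (x + x))

degree-formula : ∀ n x k ℓ → 1 ≤ x → x ≤ n →
  2 ≤ k → F k ≤ x → x < F (suc k) →
  2 ≤ ℓ → F ℓ ≤ x + n → x + n < F (suc ℓ) →
  deg n x + 𝟙 (isFib? (x + x)) + k ≡ ℓ
degree-formula n x k ℓ 1≤x x≤n 2≤k lo hi 2≤ℓ lo' hi' = begin
  deg n x + T + k                   ≡⟨ cong (deg n x + T +_) (sym (fibCount-index x k 2≤k lo hi)) ⟩
  deg n x + T + (fibCount x + 1)    ≡⟨ sym (+-assoc (deg n x + T) (fibCount x) 1) ⟩
  deg n x + T + fibCount x + 1      ≡⟨ cong (_+ 1) (deg-from x n 1≤x x≤n) ⟩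
  fibCount (x + n) + 1              ≡⟨ fibCount-index (x + n) ℓ 2≤ℓ lo' hi' ⟩
  ℓ ∎
  where
  open ≡-Reasoning
  T = 𝟙 (isFib? (x + x))

Exceptional : ℕ → ℕ → Set
Exceptional x k = x ≡ 1 ⊎ (4 ≤ k × 2 * x ≡ F (suc (suc k)))

double-bounds : ∀ a {x} → F (3 + a) ≤ x → x < F (4 + a) →
  F (4 + a) < x + x × x + x < F (6 + a)
double-bounds a lo hi =
  <-≤-trans (+-monoʳ-< (F (3 + a)) (F-strict a)) (+-mono-≤ lo lo) ,
  +-mono-≤-< (≤-trans (<⇒≤ hi) (F-step (4 + a))) hi

double-fib : ∀ a {x} → F (3 + a) ≤ x → x < F (4 + a) → IsFib (x + x) → x + x ≡ F (5 + a)
double-fib a lo hi = let (lower , upper) = double-bounds a lo hi in fib-between (4 + a) lower upper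

exceptional⇒double-fib : ∀ {x k} → Exceptional x k → IsFib (x + x)
exceptional⇒double-fib (inj₁ refl) = 3 , refl
exceptional⇒double-fib {x} {k} (inj₂ (_ , 2x≡F)) = suc (suc k) , trans (sym 2x≡F) (cong (x +_) (+-identityʳ x))

-- Conversely 2x Fibonacci forces x to be exceptional: for k = 2 the interval
-- is {1}; for k = 3 it is {2} and 4 ≠ F 5; for k ≥ 4 use double-fib.
double-fib⇒exceptional : ∀ {x} k → 2 ≤ k → F k ≤ x → x < F (suc k) → IsFib (x + x) → Exceptional x k
double-fib⇒exceptional 1 (s≤s ()) _ _ _
double-fib⇒exceptional 2 _ (s≤s z≤n) (s≤s (s≤s z≤n)) _ = inj₁ refl
double-fib⇒exceptional 3 _ lo hi fib =
  contradiction (double-fib 0 lo hi fib) (<⇒≢ (s≤s (+-mono-≤ (≤-pred hi) (≤-pred hi))))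
double-fib⇒exceptional {x} (suc (suc (suc (suc a)))) _ lo hi fib =
  inj₂ (s≤s (s≤s (s≤s (s≤s z≤n))) , trans (cong (x +_) (+-identityʳ x)) (double-fib (suc a) lo hi fib))

theorem5 : (n x k ℓ : ℕ) → 1 ≤ n → 1 ≤ x → x ≤ n →
    2 ≤ k → F k ≤ x → x < F (suc k) →
    k ≤ ℓ → F ℓ ≤ x + n → x + n < F (suc ℓ) →
    ((x ≡ 1 ⊎ (4 ≤ k × 2 * x ≡ F (suc (suc k)))) → deg n x + k + 1 ≡ ℓ)
    × (¬ (x ≡ 1 ⊎ (4 ≤ k × 2 * x ≡ F (suc (suc k)))) → deg n x + k ≡ ℓ)
theorem5 n x k ℓ _ 1≤x x≤n 2≤k lo hi k≤ℓ lo' hi' = exceptional-case , regular-case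
  where
  formula : deg n x + 𝟙 (isFib? (x + x)) + k ≡ ℓ
  formula = degree-formula n x k ℓ 1≤x x≤n 2≤k lo hi (≤-trans 2≤k k≤ℓ) lo' hi'
  exceptional-case : Exceptional x k → deg n x + k + 1 ≡ ℓ
  exceptional-case exc = begin
    deg n x + k + 1                 ≡⟨ xy∙z≈xz∙y (deg n x) k 1 ⟩
    deg n x + 1 + k                 ≡⟨ cong (λ t → deg n x + t + k) (sym (𝟙-yes (isFib? (x + x)) (exceptional⇒double-fib exc))) ⟩
    deg n x + 𝟙 (isFib? (x + x)) + k ≡⟨ formula ⟩
    ℓ ∎
    where open ≡-Reasoning
  regular-case : ¬ Exceptional x k → deg n x + k ≡ ℓ
  regular-case reg = begin
    deg n x + k                     ≡⟨ cong (_+ k) (sym (+-identityʳ (deg n x))) ⟩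
    deg n x + 0 + k                 ≡⟨ cong (λ t → deg n x + t + k) (sym (𝟙-no (isFib? (x + x)) (reg ∘ double-fib⇒exceptional k 2≤k lo hi))) ⟩
    deg n x + 𝟙 (isFib? (x + x)) + k ≡⟨ formula ⟩
    ℓ ∎
    where open ≡-Reasoning
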